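{- Let $F\in\mathcal{F}$ with decomposition $F=F_xF_y^{\mathsf U}F_y^{\mathsf L}$, and let $v$ be one of the variables $x_{i,j},y_{i,j}$. Then: (i) If $v\in c(F)$, then either $v=\mu(F_x)$ or $v$ is an ES-turn of $F$. In particular $x_{m,n}\notin c(F)$ and $y_{m,n}\notin c(F)$. (ii) If $\mu(F_x)=x_{i,j}$ with $(i,j)\ne(m,n-1)$, then $\mu(F_x)\in c(F)$. Moreover, $x_{m,n-1}\notin c(F)$. (iii) If $v$ is an ES-turn of $F_x$, then $v\in c(F)$. (iv) If $v$ is an ES-turn of $F_y^{\mathsf U}$ or of $F_y^{\mathsf L}$, then $v\in c(F)$, except when $v$ is an ES-turn of $F_y^{\mathsf U}$ with $v=y_{1,2}$, or when $v$ is an ES-turn of $F_y^{\mathsf U}$ with $v=y_{m-1,j+1}$ and $\mu(F_x)=x_{m,j}$ for some $j<n$.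
   Context: Fix integers $2<m\le n$ and variables $x_{i,j},y_{i,j}$ ($1\le i\le m$, $1\le j\le n$). Squarefree monomials are identified with their sets of variables. A lattice path monomial in the $x$-variables is a squarefree product $G=x_{i_1,j_1}x_{i_2,j_2}\cdots x_{i_t,j_t}$ ($t\ge1$) with $(i_s-i_{s-1},j_s-j_{s-1})\in\{(1,0),(0,1)\}$ for $1<s\le t$; it goes from $x_{i_1,j_1}$ to $x_{i_t,j_t}$, its leader is $\mu(G)=x_{i_1,j_1}$, a variable $x_{i_s,j_s}$ with $1<s<t$, $i_s=i_{s-1}$ and $j_s=j_{s+1}$ is an ES-turn of $G$, and its spread is $\mathrm{sp}(G)=\{x_{a,b}: i_s\le a\le m,\ 1\le b\le j_s\text{ for some }s\}$. The same notions are defined for the $y$-variables. Let $\mathcal{F}$ be the set of squarefree monomials $F=F_xF_y^{\mathsf U}F_y^{\mathsf L}$ such that, for some $(i,j)$ with $1\le i\le m$, $1\le j\le n$, $(i,j)\ne(m,n)$: $F_x$ is a lattice path monomial in the $x$-variables from $x_{i,j}$ to $x_{m,n}$; $F_y^{\mathsf U}$ is a lattice path monomial in the $y$-variables from $y_{1,1}$ to $y_{i,n}$; $F_y^{\mathsf L}$ is one from $y_{2,1}$ to $y_{m,j}$; and $F_y^{\mathsf U},F_y^{\mathsf L}$ share no variable (this decomposition is unique). (These are the facets of the simplicial complex $\Delta_0$ whose Stanley–Reisner ring is the initial-ideal quotient of the principal component of the first-order jet scheme of $2\times2$ determinantal varieties.) An ES-turn of $F$ is an ES-turn of $F_x$,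 $F_y^{\mathsf U}$ or $F_y^{\mathsf L}$. Order the $x$-variables by $x_{a,b}\prec x_{c,d}$ iff $a>c$, or $a=c$ and $b>d$. For $P,Q\in\mathcal{F}$ define $P<Q$ if (i) $\mu(P_x)\prec\mu(Q_x)$, or (ii) $\mu(P_x)=\mu(Q_x)$ and $\mathrm{sp}(P_x)\subsetneq\mathrm{sp}(Q_x)$, or (iii) $P_x=Q_x$ and $\mathrm{sp}(P_y^{\mathsf U})\subsetneq\mathrm{sp}(Q_y^{\mathsf U})$, or (iv) $P_x=Q_x$, $P_y^{\mathsf U}=Q_y^{\mathsf U}$ and $\mathrm{sp}(P_y^{\mathsf L})\subsetneq\mathrm{sp}(Q_y^{\mathsf L})$; this is a partial order. Fix any linear order $F_1,\dots,F_e$ of $\mathcal{F}$ extending $<$, and set $c(F_t)=\{v\in F_t:\ F_t\setminus F_s=\{v\}\text{ for some }s<t\}$ (the corners of $F_t$). -}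

module Defs where

open import Data.Nat using (ℕ; zero; suc; _≤_; _<_; _>_; _∸_)
open import Data.Product using (Σ; ∃; _×_; _,_)
open import Data.Sum using (_⊎_)
open import Data.List using (List; []; _∷_)
open import Data.List.Membership.Propositional using (_∈_)
open import Relation.Nullary using (¬_)
open import Relation.Binary.PropositionalEquality using (_≡_)
open import Function.Bundles using (_⇔_)

-- Coordinates (i , j) : row i, column j (1-based).
Pt : Set
Pt = ℕ × ℕ

-- Variables x_{i,j} and y_{i,j}; squarefree monomials = sets of variables,
-- represented as predicates  Var → Set.
data Var : Set where
  x : ℕ → ℕ → Var
  y : ℕ → ℕ → Var

data Dir : Set where
  D R : Dir

move : Dir → Pt → Pt
move D (i , j) = (suc i , j)
move R (i , j) = (i , suc j)

-- A lattice path monomial is given by its first point and its list of steps.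
-- points p ds = the points (i_1,j_1), ..., (i_t,j_t) of the path, in order.
points : Pt → List Dir → List Pt
points p []       = p ∷ []
points p (d ∷ ds) = p ∷ points (move d p) ds

endPt : Pt → List Dir → Pt
endPt p []       = p
endPt p (d ∷ ds) = endPt (move d p) ds

-- ES-turns: points (i_s,j_s), 1 < s < t, entered by an R step (i_s = i_{s-1})
-- and left by a D step (j_s = j_{s+1}).
turns : Pt → List Dir → List Pt
turns p []             = []
turns p (D ∷ ds)       = turns (move D p) ds
turns p (R ∷ [])       = []
turns p (R ∷ D ∷ ds)   = move R p ∷ turns (move R p) (D ∷ ds)
turns p (R ∷ R ∷ ds)   = turns (move R p) (R ∷ ds)

Spread : ℕ → Pt → List Dir → Pt → Set
Spread m p ds (a , b) =
  Σ Pt λ q → q ∈ points p ds × (Data.Product.proj₁ q ≤ a) × (a ≤ m)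
           × (1 ≤ b) × (b ≤ Data.Product.proj₂ q)

_⊊_ : (Pt → Set) → (Pt → Set) → Set
A ⊊ B = (∀ q → A q → B q) × (Σ Pt λ q → B q × ¬ A q)

-- Decomposition data of a monomial F = F_x F_y^U F_y^L:
--  F_x starts at (li , lj) = μ(F_x); F_y^U starts at (1,1); F_y^L starts at (2,1).
record Facet : Set where
  constructor facet
  field
    li lj : ℕ
    xs    : List Dir
    us    : List Dir
    ls    : List Dir
open Facet public

startU startL : Pt
startU = (1 , 1)
startL = (2 , 1)

lead : Facet → Pt
lead F = (li F , lj F)

InF : Facet → Var → Set
InF F (x a b) = (a , b) ∈ points (lead F) (xs F)
InF F (y a b) = ((a , b) ∈ points startU (us F)) ⊎ ((a , b) ∈ points startL (ls F))

IsFacet : ℕ → ℕ → Facet → Set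
IsFacet m n F =
    (1 ≤ li F) × (li F ≤ m) × (1 ≤ lj F) × (lj F ≤ n)
  × ¬ (lead F ≡ (m , n))
  × (endPt (lead F) (xs F) ≡ (m , n))
  × (endPt startU (us F) ≡ (li F , n))
  × (endPt startL (ls F) ≡ (m , lj F))
  × (∀ q → q ∈ points startU (us F) → ¬ (q ∈ points startL (ls F)))

_≺_ : Pt → Pt → Set
(a , b) ≺ (c , d) = (a > c) ⊎ ((a ≡ c) × (b > d))

FLt : ℕ → Facet → Facet → Set
FLt m P Q =
    (lead P ≺ lead Q)
  ⊎ ((lead P ≡ lead Q) × (Spread m (lead P) (xs P) ⊊ Spread m (lead Q) (xs Q)))
  ⊎ ((lead P ≡ lead Q) × (xs P ≡ xs Q)
       × (Spread m startU (us P) ⊊ Spread m startU (us Q)))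
  ⊎ ((lead P ≡ lead Q) × (xs P ≡ xs Q) × (us P ≡ us Q)
       × (Spread m startL (ls P) ⊊ Spread m startL (ls Q)))

-- A linear order F_1, ..., F_e on 𝓕 extending <, given by the (injective)
-- position function rank.
IsLinearExtension : ℕ → ℕ → (Facet → ℕ) → Set
IsLinearExtension m n rank =
    (∀ P Q → IsFacet m n P → IsFacet m n Q → rank P ≡ rank Q → P ≡ Q)
  × (∀ P Q → IsFacet m n P → IsFacet m n Q → FLt m P Q → rank P < rank Q)

-- v ∈ c(F): F \ S = {v} for some facet S earlier than F in the linear order.
Corner : ℕ → ℕ → (Facet → ℕ) → Facet → Var → Set
Corner m n rank F v =
  Σ Facet λ S → IsFacet m n S × (rank S < rank F)
    × (∀ w → ((InF F w × ¬ InF S w) ⇔ (w ≡ v)))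

ESTurn : Facet → Var → Set
ESTurn F (x a b) = (a , b) ∈ turns (lead F) (xs F)
ESTurn F (y a b) = ((a , b) ∈ turns startU (us F)) ⊎ ((a , b) ∈ turns startL (ls F))

-- A lattice path meets each
-- diagonal i + j = const at most once, and on every diagonal they share the upper y-path
-- lies strictly above the lower one. Comparing F and S diagonal by diagonal shows that if v
-- is neither the lead nor an ES-turn, then either lead F ≺ lead S, or F and S share their
-- lead and on the first path where they differ S bends outward where F bends inward at v,
-- so S has the larger spread; either way F < S. Conversely, an ES-turn is removed by
-- flipping it to the opposite corner, which shrinks the spread, and the lead x_{i,j} is
-- removed by starting F_x one step later and extending a y-path by the freed cell, flipping
-- the other y-path out of the way if it occupies that cell. The exceptions in (ii) and (iv)
-- are the configurations in which this construction breaks down.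

module Submission where

open import Defs
open import Data.Nat using (ℕ; zero; suc; _≤_; _<_; _∸_; _+_; _≟_; z≤n; s≤s)
open import Data.Nat.Properties
open import Data.Product using (_×_; _,_; Σ; ∃; ∃₂; proj₁; proj₂)
open import Data.Product.Properties using (≡-dec; ,-injectiveˡ; ,-injectiveʳ)
open import Data.Sum using (_⊎_; inj₁; inj₂)
open import Data.List using (List; []; _∷_; _++_; _∷ʳ_)
open import Data.List.Relation.Unary.Any using (here; there; any?)
open import Data.List.Membership.Propositional using (_∈_; _∉_; find; lose)
open import Data.List.Relation.Binary.Subset.Propositional using (_⊆_)
open import Data.Empty using (⊥-elim)
open import Relation.Nullary using (¬_; Dec; yes; no; ¬?; _⊎-dec_)
open import Relation.Nullary.Decidable using (decidable-stable)
open import Relation.Binary.Definitions using (DecidableEquality)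
open import Relation.Binary.PropositionalEquality
open import Function.Bundles using (_⇔_; mk⇔; Equivalence)
open import Function.Base using (_∘_)

suc[k∸1]≡k : ∀ {k} → 1 < k → suc (k ∸ 1) ≡ k
suc[k∸1]≡k (s≤s (s≤s _)) = refl

<⇒≤∸1 : ∀ {a b} → a < b → a ≤ b ∸ 1
<⇒≤∸1 (s≤s a≤b) = a≤b

-- Lattice paths

row col diag : Pt → ℕ
row = proj₁
col = proj₂
diag q = row q + col q

infix 4 _≤ᴾ_ _≟ᴾ_

_≤ᴾ_ : Pt → Pt → Set
p ≤ᴾ q = row p ≤ row q × col p ≤ col q

_≟ᴾ_ : DecidableEquality Pt
_≟ᴾ_ = ≡-dec _≟_ _≟_

open import Data.List.Membership.DecPropositional _≟ᴾ_ using (_∈?_)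

variable
  p q r : Pt
  d e : Dir
  k : ℕ

≤ᴾ-refl : p ≤ᴾ p
≤ᴾ-refl = ≤-refl , ≤-refl

≤ᴾ-trans : p ≤ᴾ q → q ≤ᴾ r → p ≤ᴾ r
≤ᴾ-trans (a , b) (c , d) = ≤-trans a c , ≤-trans b d

diag-mono : p ≤ᴾ q → diag p ≤ diag q
diag-mono (a , b) = +-mono-≤ a b

row≡∧diag≡⇒≡ : row p ≡ row q → diag p ≡ diag q → p ≡ q
row≡∧diag≡⇒≡ {i , j} {.i , j′} refl eq = cong (i ,_) (+-cancelˡ-≡ i j j′ eq)

≤ᴾ∧diag≡⇒≡ : p ≤ᴾ q → diag p ≡ diag q → p ≡ q
≤ᴾ∧diag≡⇒≡ {p} {q} (a , b) eq with row p ≟ row q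
... | yes same = row≡∧diag≡⇒≡ same eq
... | no diff  = ⊥-elim (<-irrefl eq (+-mono-<-≤ (≤∧≢⇒< a diff) b))

≤ᴾ-move : ∀ d p → p ≤ᴾ move d p
≤ᴾ-move D p = n≤1+n _ , ≤-refl
≤ᴾ-move R p = ≤-refl , n≤1+n _

diag-move : ∀ d p → diag (move d p) ≡ suc (diag p)
diag-move D p = refl
diag-move R p = +-suc (row p) (col p)

diag<diag-move : ∀ d p → diag p < diag (move d p)
diag<diag-move d p = ≤-reflexive (sym (diag-move d p))

diag-move-D≡R : ∀ p → diag (move D p) ≡ diag (move R p)
diag-move-D≡R p = trans (diag-move D p) (sym (diag-move R p))

move≰ᴾ : ∀ d p → ¬ move d p ≤ᴾ p
move≰ᴾ d p le = <⇒≱ (diag<diag-move d p) (diag-mono le)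

≤ᴾ⇒move≢ : ∀ d → p ≤ᴾ q → move d q ≢ p
≤ᴾ⇒move≢ {q = q} d le refl = move≰ᴾ d q le

move-injective : ∀ d → move d p ≡ move d q → p ≡ q
move-injective D eq = cong₂ _,_ (suc-injective (,-injectiveˡ eq)) (,-injectiveʳ eq)
move-injective R eq = cong₂ _,_ (,-injectiveˡ eq) (suc-injective (,-injectiveʳ eq))

move-dir-injective : ∀ p → move d p ≡ move e p → d ≡ e
move-dir-injective {D} {D} p eq = refl
move-dir-injective {D} {R} p eq = ⊥-elim (1+n≢n (,-injectiveˡ eq))
move-dir-injective {R} {D} p eq = ⊥-elim (1+n≢n (sym (,-injectiveˡ eq)))
move-dir-injective {R} {R} p eq = refl

move-comm : ∀ d e p → move e (move d p) ≡ move d (move e p)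
move-comm D D p = refl
move-comm D R p = refl
move-comm R D p = refl
move-comm R R p = refl

row-move≤ : ∀ d p → row (move d p) ≤ suc (row p)
row-move≤ D p = ≤-refl
row-move≤ R p = n≤1+n _

start∈points : ∀ p ds → p ∈ points p ds
start∈points p []       = here refl
start∈points p (d ∷ ds) = here refl

end∈points : ∀ p ds → endPt p ds ∈ points p ds
end∈points p []       = here refl
end∈points p (d ∷ ds) = there (end∈points (move d p) ds)

start≤ᴾpoint : ∀ p ds → q ∈ points p ds → p ≤ᴾ q
start≤ᴾpoint p []       (here refl) = ≤ᴾ-refl
start≤ᴾpoint p (d ∷ ds) (here refl) = ≤ᴾ-refl
start≤ᴾpoint p (d ∷ ds) (there h)   = ≤ᴾ-trans (≤ᴾ-move d p) (start≤ᴾpoint (move d p) ds h)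

point≤ᴾend : ∀ p ds → q ∈ points p ds → q ≤ᴾ endPt p ds
point≤ᴾend p []       (here refl) = ≤ᴾ-refl
point≤ᴾend p (d ∷ ds) (here refl) = start≤ᴾpoint p (d ∷ ds) (end∈points p (d ∷ ds))
point≤ᴾend p (d ∷ ds) (there h)   = point≤ᴾend (move d p) ds h

endPt-∷≢start : ∀ p d ds → endPt p (d ∷ ds) ≢ p
endPt-∷≢start p d ds eq =
  <⇒≱ (diag<diag-move d p)
      (subst (λ z → diag (move d p) ≤ diag z) eq (diag-mono (point≤ᴾend (move d p) ds (start∈points _ ds))))

points-comparable : ∀ p ds → q ∈ points p ds → r ∈ points p ds → q ≤ᴾ r ⊎ r ≤ᴾ q
points-comparable p []       (here refl) (here refl) = inj₁ ≤ᴾ-refl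
points-comparable p (d ∷ ds) (here refl) r∈          = inj₁ (start≤ᴾpoint p (d ∷ ds) r∈)
points-comparable p (d ∷ ds) (there q∈)  (here refl) = inj₂ (start≤ᴾpoint p (d ∷ ds) (there q∈))
points-comparable p (d ∷ ds) (there q∈)  (there r∈)  = points-comparable (move d p) ds q∈ r∈

points-row<⇒col≤ : ∀ p ds → q ∈ points p ds → r ∈ points p ds → row q < row r → col q ≤ col r
points-row<⇒col≤ p ds q∈ r∈ lt with points-comparable p ds q∈ r∈
... | inj₁ (_ , le) = le
... | inj₂ (le , _) = ⊥-elim (<⇒≱ lt le)

points-diag-injective : ∀ p ds → q ∈ points p ds → r ∈ points p ds → diag q ≡ diag r → q ≡ r
points-diag-injective p ds q∈ r∈ eq with points-comparable p ds q∈ r∈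
... | inj₁ le = ≤ᴾ∧diag≡⇒≡ le eq
... | inj₂ le = sym (≤ᴾ∧diag≡⇒≡ le (sym eq))

points-pred : ∀ p ds → q ∈ points p ds → q ≢ p → ∃₂ λ d r → r ∈ points p ds × q ≡ move d r
points-pred p []       (here refl) q≢p = ⊥-elim (q≢p refl)
points-pred p (d ∷ ds) (here refl) q≢p = ⊥-elim (q≢p refl)
points-pred {q} p (d ∷ ds) (there h) q≢p with q ≟ᴾ move d p
... | yes refl = d , p , here refl , refl
... | no q≢dp with points-pred (move d p) ds h q≢dp
...   | d′ , r , r∈ , eq = d′ , r , there r∈ , eq

points-succ : ∀ p ds → q ∈ points p ds → q ≢ endPt p ds → ∃ λ d → move d q ∈ points p ds
points-succ p []       (here refl) q≢end = ⊥-elim (q≢end refl)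
points-succ p (d ∷ ds) (here refl) q≢end = d , there (start∈points (move d p) ds)
points-succ p (d ∷ ds) (there h)   q≢end with points-succ (move d p) ds h q≢end
... | d′ , h′ = d′ , there h′

points-meet-diag : ∀ p ds → diag p ≤ k → k ≤ diag (endPt p ds) → ∃ λ q → q ∈ points p ds × diag q ≡ k
points-meet-diag p []       lo hi = p , here refl , ≤-antisym lo hi
points-meet-diag {k} p (d ∷ ds) lo hi with diag p ≟ k
... | yes eq = p , here refl , eq
... | no neq with points-meet-diag (move d p) ds (subst (_≤ k) (sym (diag-move d p)) (≤∧≢⇒< lo neq)) hi
...   | q , q∈ , eq = q , there q∈ , eq

endPt-++ : ∀ p ds es → endPt p (ds ++ es) ≡ endPt (endPt p ds) es
endPt-++ p []       es = refl
endPt-++ p (d ∷ ds) es = endPt-++ (move d p) ds es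

points-++⁻ : ∀ p ds es → q ∈ points p (ds ++ es) → q ∈ points p ds ⊎ q ∈ points (endPt p ds) es
points-++⁻ p []       es h           = inj₂ h
points-++⁻ p (d ∷ ds) es (here refl) = inj₁ (here refl)
points-++⁻ p (d ∷ ds) es (there h) with points-++⁻ (move d p) ds es h
... | inj₁ h′ = inj₁ (there h′)
... | inj₂ h′ = inj₂ h′

points-++ˡ : ∀ p ds es → q ∈ points p ds → q ∈ points p (ds ++ es)
points-++ˡ p []       es (here refl) = start∈points p es
points-++ˡ p (d ∷ ds) es (here refl) = here refl
points-++ˡ p (d ∷ ds) es (there h)   = there (points-++ˡ (move d p) ds es h)

points-++ʳ : ∀ p ds es → q ∈ points (endPt p ds) es → q ∈ points p (ds ++ es)
points-++ʳ p []       es h = h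
points-++ʳ p (d ∷ ds) es h = there (points-++ʳ (move d p) ds es h)

points-after-prefix : ∀ p ds es → q ∈ points p (ds ++ es) → ¬ q ≤ᴾ endPt p ds → q ∈ points (endPt p ds) es
points-after-prefix p ds es h q≰ with points-++⁻ p ds es h
... | inj₁ h′ = ⊥-elim (q≰ (point≤ᴾend p ds h′))
... | inj₂ h′ = h′

points-split : ∀ p ds → q ∈ points p ds → ∃₂ λ ds₁ ds₂ → ds ≡ ds₁ ++ ds₂ × endPt p ds₁ ≡ q
points-split p []       (here refl) = [] , [] , refl , refl
points-split p (d ∷ ds) (here refl) = [] , d ∷ ds , refl , refl
points-split p (d ∷ ds) (there h) with points-split (move d p) ds h
... | ds₁ , ds₂ , refl , eq = d ∷ ds₁ , ds₂ , refl , eq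

endPt-∷ʳ : ∀ p ds d → endPt p (ds ∷ʳ d) ≡ move d (endPt p ds)
endPt-∷ʳ p ds d = endPt-++ p ds (d ∷ [])

new-end∈points-∷ʳ : ∀ p ds d → move d (endPt p ds) ∈ points p (ds ∷ʳ d)
new-end∈points-∷ʳ p ds d = points-++ʳ p ds (d ∷ []) (there (here refl))

points-∷ʳ⁻ : ∀ p ds d → q ∈ points p (ds ∷ʳ d) → q ∈ points p ds ⊎ q ≡ move d (endPt p ds)
points-∷ʳ⁻ p ds d h with points-++⁻ p ds (d ∷ []) h
... | inj₁ h′                  = inj₁ h′
... | inj₂ (here refl)         = inj₁ (end∈points p ds)
... | inj₂ (there (here q≡))   = inj₂ q≡

first-step : ∀ p ds → move d p ∈ points p ds → ∃ λ ds′ → ds ≡ d ∷ ds′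
first-step {d} p []       (here eq) = ⊥-elim (≤ᴾ⇒move≢ d ≤ᴾ-refl eq)
first-step {d} p (e ∷ ds) (here eq) = ⊥-elim (≤ᴾ⇒move≢ d ≤ᴾ-refl eq)
first-step {d} p (e ∷ ds) (there h)
  with move-dir-injective {e} {d} p (≤ᴾ∧diag≡⇒≡ (start≤ᴾpoint (move e p) ds h)
                                       (trans (diag-move e p) (sym (diag-move d p))))
... | refl = ds , refl

step-split : ∀ p ds → q ∈ points p ds → move d q ∈ points p ds
           → ∃₂ λ ds₁ ds₂ → ds ≡ ds₁ ++ d ∷ ds₂ × endPt p ds₁ ≡ q
step-split {d = d} p ds q∈ dq∈ with points-split p ds q∈
... | ds₁ , ds₂ , refl , refl
  with first-step (endPt p ds₁) ds₂ (points-after-prefix p ds₁ ds₂ dq∈ (move≰ᴾ d _))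
...   | ds₂′ , refl = ds₁ , ds₂′ , refl , refl

two-step-split : ∀ p ds → q ∈ points p ds → move d q ∈ points p ds → move e (move d q) ∈ points p ds
               → ∃₂ λ ds₁ ds₂ → ds ≡ ds₁ ++ d ∷ e ∷ ds₂ × endPt p ds₁ ≡ q
two-step-split {d = d} {e = e} p ds q∈ dq∈ edq∈ with step-split p ds q∈ dq∈
... | ds₁ , ds₂ , refl , refl
  with points-after-prefix p ds₁ (d ∷ ds₂) edq∈ (λ le → move≰ᴾ e _ (≤ᴾ-trans le (≤ᴾ-move d _)))
...   | here eq = ⊥-elim (≤ᴾ⇒move≢ e (≤ᴾ-move d _) eq)
...   | there h with first-step (move d (endPt p ds₁)) ds₂ h
...     | ds₂′ , refl = ds₁ , ds₂′ , refl , refl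

same-end∧points-⊆⇒≡ : ∀ p ds es → endPt p ds ≡ endPt p es → points p ds ⊆ points p es → ds ≡ es
same-end∧points-⊆⇒≡ p []       []       _   _  = refl
same-end∧points-⊆⇒≡ p []       (e ∷ es) end _  = ⊥-elim (endPt-∷≢start p e es (sym end))
same-end∧points-⊆⇒≡ p (d ∷ ds) []       end _  = ⊥-elim (endPt-∷≢start p d ds end)
same-end∧points-⊆⇒≡ p (d ∷ ds) (e ∷ es) end ⊆es
  with first-step p (e ∷ es) (⊆es (there (start∈points (move d p) ds)))
... | _ , refl = cong (d ∷_) (same-end∧points-⊆⇒≡ (move d p) ds es end tail⊆)
  where
  tail⊆ : points (move d p) ds ⊆ points (move d p) es
  tail⊆ h with ⊆es (there h)
  ... | here eq  = ⊥-elim (move≰ᴾ d p (subst (move d p ≤ᴾ_) eq (start≤ᴾpoint (move d p) ds h)))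
  ... | there h′ = h′

turns-split : ∀ p ds → q ∈ turns p ds → ∃₂ λ ds₁ ds₂ → ds ≡ ds₁ ++ R ∷ D ∷ ds₂ × q ≡ move R (endPt p ds₁)
turns-split p (D ∷ ds) t with turns-split (move D p) ds t
... | ds₁ , ds₂ , split , eq = D ∷ ds₁ , ds₂ , cong (D ∷_) split , eq
turns-split p (R ∷ D ∷ ds) (here refl) = [] , ds , refl , refl
turns-split p (R ∷ D ∷ ds) (there t) with turns-split (move R p) (D ∷ ds) t
... | ds₁ , ds₂ , split , eq = R ∷ ds₁ , ds₂ , cong (R ∷_) split , eq
turns-split p (R ∷ R ∷ ds) t with turns-split (move R p) (R ∷ ds) t
... | ds₁ , ds₂ , split , eq = R ∷ ds₁ , ds₂ , cong (R ∷_) split , eq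

turns-∷ : ∀ d p ds → q ∈ turns (move d p) ds → q ∈ turns p (d ∷ ds)
turns-∷ D p ds       t = t
turns-∷ R p (D ∷ ds) t = there t
turns-∷ R p (R ∷ ds) t = t

turn-at-split : ∀ p ds₁ ds₂ → move R (endPt p ds₁) ∈ turns p (ds₁ ++ R ∷ D ∷ ds₂)
turn-at-split p []        ds₂ = here refl
turn-at-split p (d ∷ ds₁) ds₂ = turns-∷ d p (ds₁ ++ R ∷ D ∷ ds₂) (turn-at-split (move d p) ds₁ ds₂)

corner⇒turn : ∀ p ds → q ∈ points p ds → move R q ∈ points p ds → move D (move R q) ∈ points p ds
            → move R q ∈ turns p ds
corner⇒turn p ds q∈ rq∈ drq∈ with two-step-split {d = R} {e = D} p ds q∈ rq∈ drq∈
... | ds₁ , ds₂ , refl , refl = turn-at-split p ds₁ ds₂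

turn⇒corner : ∀ p ds → q ∈ turns p ds
            → ∃ λ q′ → q ≡ move R q′ × q′ ∈ points p ds × move D q ∈ points p ds
turn⇒corner p ds t with turns-split p ds t
... | ds₁ , ds₂ , refl , refl =
  endPt p ds₁ , refl , points-++ʳ p ds₁ (R ∷ D ∷ ds₂) (here refl)
              , points-++ʳ p ds₁ (R ∷ D ∷ ds₂) (there (there (start∈points _ ds₂)))

turn-row<end : ∀ p ds → q ∈ turns p ds → row q < row (endPt p ds)
turn-row<end p ds t with turn⇒corner p ds t
... | _ , _ , _ , dq∈ = proj₁ (point≤ᴾend p ds dq∈)

move-D-point∉turns : ∀ p ds → q ∈ points p ds → move D q ∉ turns p ds
move-D-point∉turns {q} p ds q∈ t with turn⇒corner p ds t
... | q′ , eq , q′∈ , _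
  with points-diag-injective p ds q∈ q′∈
         (suc-injective (trans (sym (diag-move D q)) (trans (cong diag eq) (diag-move R q′))))
... | refl with move-dir-injective {D} {R} q eq
...   | ()

-- Spreads

spread-⊊-at-SE-corner : ∀ m p ds es i j → row (endPt p es) ≤ m
  → (i , j) ∈ points p es → (i , suc j) ∈ points p es → (suc i , j) ∈ points p ds
  → (∀ {q} → q ∈ points p ds → q ≢ (suc i , j) → q ∈ points p es)
  → Spread m p ds ⊊ Spread m p es
spread-⊊-at-SE-corner m p ds es i j end≤m w∈es es-corner∈es v∈ds rest⊆ =
  spread⊆ , (i , suc j) , es-corner∈spread , es-corner∉spread
  where
  spread⊆ : ∀ t → Spread m p ds t → Spread m p es t
  spread⊆ t (q , q∈ , q≤t , t≤m , 1≤t , t≤q) with q ≟ᴾ (suc i , j)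
  ... | yes refl = (i , j) , w∈es , ≤-trans (n≤1+n i) q≤t , t≤m , 1≤t , t≤q
  ... | no q≢v   = q , rest⊆ q∈ q≢v , q≤t , t≤m , 1≤t , t≤q
  es-corner∈spread : Spread m p es (i , suc j)
  es-corner∈spread =
    (i , suc j) , es-corner∈es , ≤-refl , ≤-trans (proj₁ (point≤ᴾend p es es-corner∈es)) end≤m , s≤s z≤n , ≤-refl
  es-corner∉spread : ¬ Spread m p ds (i , suc j)
  es-corner∉spread (q , q∈ , q≤i , _ , _ , j<q) =
    1+n≰n (≤-trans j<q (points-row<⇒col≤ p ds q∈ v∈ds (s≤s q≤i)))

spread-⊊-around : ∀ m p ds es w d d′ e → d ≢ e → row (endPt p es) ≤ m
  → w ∈ points p ds → move d w ∈ points p ds → move d′ (move d w) ∈ points p ds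
  → w ∈ points p es → move e w ∈ points p es → move d′ (move d w) ∈ points p es
  → move d w ∉ turns p ds
  → (∀ {q} → q ∈ points p ds → q ≢ move d w → q ∈ points p es)
  → Spread m p ds ⊊ Spread m p es
spread-⊊-around m p ds es w R D e _   _ w∈ v∈ z∈ _ _ _ not-turn _ =
  ⊥-elim (not-turn (corner⇒turn p ds w∈ v∈ z∈))
spread-⊊-around m p ds es w R R D _   _ _ _ _ _ b∈ z∈ _ _ =
  ⊥-elim (1+n≰n (≤-trans (n≤1+n _) (points-row<⇒col≤ p es z∈ b∈ ≤-refl)))
spread-⊊-around m p ds es w R R R R≢R _ _ _ _ _ _ _ _ _ = ⊥-elim (R≢R refl)
spread-⊊-around m p ds es w D D R _   _ _ _ _ _ b∈ z∈ _ _ =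
  ⊥-elim (1+n≰n (points-row<⇒col≤ p es b∈ z∈ (n≤1+n _)))
spread-⊊-around m p ds es w D D D D≢D _ _ _ _ _ _ _ _ _ = ⊥-elim (D≢D refl)
spread-⊊-around m p ds es w D R D D≢D _ _ _ _ _ _ _ _ _ = ⊥-elim (D≢D refl)
spread-⊊-around m p ds es (i , j) D R R _ end≤m _ v∈ _ w∈es b∈ _ _ rest⊆ =
  spread-⊊-at-SE-corner m p ds es i j end≤m w∈es b∈ v∈ rest⊆

-- v = move d w for its predecessor w, and es leaves w by the other step; since v is no
-- ES-turn of ds, the only consistent configuration is ds turning D,R at w and es R,D.
spread-⊊ : ∀ m p ds es {v} → endPt p ds ≡ endPt p es → row (endPt p es) ≤ m
  → v ∈ points p ds → v ≢ p → v ∉ points p es → v ∉ turns p ds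
  → (∀ {q} → q ∈ points p ds → q ≢ v → q ∈ points p es)
  → Spread m p ds ⊊ Spread m p es
spread-⊊ m p ds es same-end end≤m v∈ v≢p v∉ not-turn rest⊆ with points-pred p ds v∈ v≢p
... | d , w , w∈ , refl
  with points-succ p ds v∈ (λ eq → v∉ (subst (_∈ points p es) (sym (trans eq same-end)) (end∈points p es)))
...   | d′ , z∈ with rest⊆ w∈ (≤ᴾ⇒move≢ d ≤ᴾ-refl ∘ sym)
...     | w∈es
  with points-succ p es w∈es
         (λ eq → move≰ᴾ d w (subst (move d w ≤ᴾ_) (trans same-end (sym eq)) (point≤ᴾend p ds v∈)))
...       | e , b∈ =
  spread-⊊-around m p ds es w d d′ e (λ { refl → v∉ b∈ }) end≤m w∈ v∈ z∈ w∈es b∈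
    (rest⊆ z∈ (≤ᴾ⇒move≢ d′ ≤ᴾ-refl)) not-turn rest⊆

module Flip (p : Pt) (ds₁ ds₂ : List Dir) where

  base es-corner se-corner : Pt
  base      = endPt p ds₁
  es-corner = move R base
  se-corner = move D base

  viaES viaSE : List Dir
  viaES = ds₁ ++ R ∷ D ∷ ds₂
  viaSE = ds₁ ++ D ∷ R ∷ ds₂

  private
    swapped : Dir → Dir → List Dir
    swapped d₁ d₂ = ds₁ ++ d₁ ∷ d₂ ∷ ds₂

    swap-endPt : ∀ d₁ d₂ → endPt p (swapped d₁ d₂) ≡ endPt p (swapped d₂ d₁)
    swap-endPt d₁ d₂ = begin
      endPt p (swapped d₁ d₂)              ≡⟨ endPt-++ p ds₁ (d₁ ∷ d₂ ∷ ds₂) ⟩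
      endPt (move d₂ (move d₁ base)) ds₂   ≡⟨ cong (λ z → endPt z ds₂) (move-comm d₁ d₂ base) ⟩
      endPt (move d₁ (move d₂ base)) ds₂   ≡⟨ endPt-++ p ds₁ (d₂ ∷ d₁ ∷ ds₂) ⟨
      endPt p (swapped d₂ d₁)              ∎
      where open ≡-Reasoning

    swap-⊆ : ∀ d₁ d₂ → q ∈ points p (swapped d₁ d₂) → q ≢ move d₁ base → q ∈ points p (swapped d₂ d₁)
    swap-⊆ {q} d₁ d₂ h q≢ with points-++⁻ p ds₁ (d₁ ∷ d₂ ∷ ds₂) h
    ... | inj₁ h′                     = points-++ˡ p ds₁ (d₂ ∷ d₁ ∷ ds₂) h′
    ... | inj₂ (here refl)            = points-++ʳ p ds₁ (d₂ ∷ d₁ ∷ ds₂) (here refl)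
    ... | inj₂ (there (here refl))    = ⊥-elim (q≢ refl)
    ... | inj₂ (there (there h′))     = points-++ʳ p ds₁ (d₂ ∷ d₁ ∷ ds₂)
      (there (there (subst (λ z → q ∈ points z ds₂) (move-comm d₁ d₂ base) h′)))

    base∈ : ∀ d₁ d₂ → base ∈ points p (swapped d₁ d₂)
    base∈ d₁ d₂ = points-++ʳ p ds₁ (d₁ ∷ d₂ ∷ ds₂) (here refl)

    corner∈ : ∀ d₁ d₂ → move d₁ base ∈ points p (swapped d₁ d₂)
    corner∈ d₁ d₂ = points-++ʳ p ds₁ (d₁ ∷ d₂ ∷ ds₂) (there (here refl))

    other-corner∉ : ∀ d₁ d₂ → d₁ ≢ d₂ → move d₂ base ∉ points p (swapped d₁ d₂)
    other-corner∉ d₁ d₂ d₁≢d₂ h = d₁≢d₂ (move-dir-injective base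
      (points-diag-injective p _ (corner∈ d₁ d₂) h (trans (diag-move d₁ base) (sym (diag-move d₂ base)))))

  endPt-viaSE : endPt p viaSE ≡ endPt p viaES
  endPt-viaSE = swap-endPt D R

  viaES∖es-corner⊆viaSE : q ∈ points p viaES → q ≢ es-corner → q ∈ points p viaSE
  viaES∖es-corner⊆viaSE = swap-⊆ R D

  viaSE∖se-corner⊆viaES : q ∈ points p viaSE → q ≢ se-corner → q ∈ points p viaES
  viaSE∖se-corner⊆viaES = swap-⊆ D R

  base∈viaES : base ∈ points p viaES
  base∈viaES = base∈ R D

  es-corner∈viaES : es-corner ∈ points p viaES
  es-corner∈viaES = corner∈ R D

  below-es-corner∈viaES : move D es-corner ∈ points p viaES
  below-es-corner∈viaES = points-++ʳ p ds₁ (R ∷ D ∷ ds₂) (there (there (start∈points _ ds₂)))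

  se-corner∈viaSE : se-corner ∈ points p viaSE
  se-corner∈viaSE = corner∈ D R

  es-corner∉viaSE : es-corner ∉ points p viaSE
  es-corner∉viaSE = other-corner∉ D R λ ()

  se-corner∉viaES : se-corner ∉ points p viaES
  se-corner∉viaES = other-corner∉ R D λ ()

  spread-viaSE⊊viaES : ∀ m → row (endPt p viaES) ≤ m → Spread m p viaSE ⊊ Spread m p viaES
  spread-viaSE⊊viaES m end≤m =
    spread-⊊ m p viaSE viaES endPt-viaSE end≤m se-corner∈viaSE
      (≤ᴾ⇒move≢ D (start≤ᴾpoint p viaSE (base∈ D R))) se-corner∉viaES
      (move-D-point∉turns p viaSE (base∈ D R)) viaSE∖se-corner⊆viaES

-- Pairs of y-paths

YDisjoint : List Dir → List Dir → Set
YDisjoint us ls = ∀ q → q ∈ points startU us → q ∉ points startL ls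

upper-row<lower-row : ∀ us ls → YDisjoint us ls → ∀ {u l}
  → u ∈ points startU us → l ∈ points startL ls → diag u ≡ diag l → row u < row l
upper-row<lower-row us ls disj = go _ refl
  where
  strict : ∀ {u l} → u ∈ points startU us → l ∈ points startL ls → diag u ≡ diag l
         → row u ≤ row l → row u < row l
  strict u∈ l∈ eq le =
    ≤∧≢⇒< le λ req → disj _ u∈ (subst (_∈ points startL ls) (sym (row≡∧diag≡⇒≡ req eq)) l∈)

  go : ∀ k {u l} → diag l ≡ k → u ∈ points startU us → l ∈ points startL ls
     → diag u ≡ diag l → row u < row l
  go k {u} {l} diag≡k u∈ l∈ eq
    with points-pred startU us u∈ (λ { refl → 1+n≰n (subst (3 ≤_) (sym eq) (diag-mono (start≤ᴾpoint startL ls l∈))) })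
  ... | d , u′ , u′∈ , refl with l ≟ᴾ startL
  ...   | yes refl = strict u∈ l∈ eq (≤-trans (row-move≤ d u′) (s≤s (≤-reflexive (cong row u′≡start))))
    where
    u′≡start : u′ ≡ startU
    u′≡start = sym (≤ᴾ∧diag≡⇒≡ (start≤ᴾpoint startU us u′∈) (sym (suc-injective (trans (sym (diag-move d u′)) eq))))
  go zero    diag≡k u∈ l∈ eq | d , u′ , u′∈ , refl | no l≢start
    with subst (3 ≤_) diag≡k (diag-mono (start≤ᴾpoint startL ls l∈))
  ... | ()
  go (suc k) diag≡k u∈ l∈ eq | d , u′ , u′∈ , refl | no l≢start with points-pred startL ls l∈ l≢start
  ... | e , l′ , l′∈ , refl =
    strict u∈ l∈ eq (≤-trans (row-move≤ d u′) (≤-trans above (proj₁ (≤ᴾ-move e l′))))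
    where
    above : row u′ < row l′
    above = go k (suc-injective (trans (sym (diag-move e l′)) diag≡k)) u′∈ l′∈
              (suc-injective (trans (sym (diag-move d u′)) (trans eq (diag-move e l′))))

⊆⊎counterexample : (A B : List Pt) → A ⊆ B ⊎ ∃ λ q → q ∈ A × q ∉ B
⊆⊎counterexample A B with any? (λ q → ¬? (q ∈? B)) A
... | yes some = inj₂ (find some)
... | no none  = inj₁ λ q∈A → decidable-stable (_ ∈? B) λ q∉B → none (lose q∈A q∉B)

module CompareYPaths (m : ℕ) (us ls us′ ls′ : List Dir)
  (U-end : endPt startU us ≡ endPt startU us′) (L-end : endPt startL ls ≡ endPt startL ls′)
  (U′-end≤m : row (endPt startU us′) ≤ m) (L′-end≤m : row (endPt startL ls′) ≤ m)
  (F-disj : YDisjoint us ls) (S-disj : YDisjoint us′ ls′) {v : Pt}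
  (rest⊆ : ∀ {q} → q ∈ points startU us ⊎ q ∈ points startL ls → q ≢ v
         → q ∈ points startU us′ ⊎ q ∈ points startL ls′)
  (v∉U′ : v ∉ points startU us′) (v∉L′ : v ∉ points startL ls′) where

  U L U′ L′ : List Pt
  U  = points startU us
  L  = points startL ls
  U′ = points startU us′
  L′ = points startL ls′

  -- On every diagonal other than that of v, F and S have the same y-points, and in both
  -- facets the upper one lies on the upper path.
  upper-kept-off-diag : q ∈ U → diag q ≢ diag v → q ∈ U′
  upper-kept-off-diag {q} q∈U off with rest⊆ (inj₁ q∈U) (off ∘ cong diag)
  ... | inj₁ q∈U′ = q∈U′
  ... | inj₂ q∈L′
    with points-meet-diag startL ls (diag-mono (start≤ᴾpoint startL ls′ q∈L′))
           (subst (λ z → diag q ≤ diag z) (sym L-end) (diag-mono (point≤ᴾend startL ls′ q∈L′)))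
  ...   | l , l∈L , diag-l with rest⊆ (inj₂ l∈L) (λ l≡v → off (trans (sym diag-l) (cong diag l≡v)))
  ...     | inj₂ l∈L′ = ⊥-elim (F-disj q q∈U (subst (_∈ L) (points-diag-injective startL ls′ l∈L′ q∈L′ diag-l) l∈L))
  ...     | inj₁ l∈U′ = ⊥-elim (<-asym (upper-row<lower-row us′ ls′ S-disj l∈U′ q∈L′ diag-l)
                                       (upper-row<lower-row us ls F-disj q∈U l∈L (sym diag-l)))

  lost-upper-on-diag : q ∈ U → q ∉ U′ → diag q ≡ diag v
  lost-upper-on-diag {q} q∈U q∉U′ with diag q ≟ diag v
  ... | yes eq  = eq
  ... | no  off = ⊥-elim (q∉U′ (upper-kept-off-diag q∈U off))

  lost-upper∈L′ : v ∈ L → q ∈ U → q ∉ U′ → q ∈ L′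
  lost-upper∈L′ v∈L q∈U q∉U′ with rest⊆ (inj₁ q∈U) (λ { refl → F-disj _ q∈U v∈L })
  ... | inj₁ q∈U′ = ⊥-elim (q∉U′ q∈U′)
  ... | inj₂ q∈L′ = q∈L′

  -- If q = move R q′ were an ES-turn of U, then q′ ∈ U′, and the point of U′ on the diagonal
  -- of q lies above q ∈ L′, hence strictly above q′: impossible on a monotone path.
  lost-upper∉turns : v ∈ L → q ∈ U → q ∉ U′ → q ∉ turns startU us
  lost-upper∉turns {q} v∈L q∈U q∉U′ q-turn with turn⇒corner startU us q-turn
  ... | q′ , refl , q′∈U , below∈U
    with points-meet-diag startU us′ (diag-mono (start≤ᴾpoint startU us q∈U))
           (subst (λ z → diag q ≤ diag z) U-end (diag-mono (point≤ᴾend startU us q∈U)))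
  ...   | w , w∈U′ , diag-w = <⇒≱ (≤-trans (+-mono-<-≤ w-above w-left) (n≤1+n _))
                                  (≤-reflexive (trans (sym (diag-move R q′)) (sym diag-w)))
    where
    diag-q′ : diag q′ ≢ diag v
    diag-q′ eq = <⇒≢ (diag<diag-move R q′) (trans eq (sym (lost-upper-on-diag q∈U q∉U′)))
    q′∈U′ : q′ ∈ U′
    q′∈U′ = upper-kept-off-diag q′∈U diag-q′
    w-above : row w < row q′
    w-above = upper-row<lower-row us′ ls′ S-disj w∈U′ (lost-upper∈L′ v∈L q∈U q∉U′) diag-w
    w-left : col w ≤ col q′
    w-left = points-row<⇒col≤ startU us′ w∈U′ q′∈U′ w-above

  upper-kept : v ∈ U → q ∈ U → q ≢ v → q ∈ U′
  upper-kept v∈U q∈U q≢v = upper-kept-off-diag q∈U (q≢v ∘ points-diag-injective startU us q∈U v∈U)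

  y-spread-⊊ : v ∉ turns startU us → v ∉ turns startL ls → v ∈ U ⊎ v ∈ L
    → Spread m startU us ⊊ Spread m startU us′
    ⊎ (us ≡ us′ × Spread m startL ls ⊊ Spread m startL ls′)
  y-spread-⊊ v∉turnsU _ (inj₁ v∈U) =
    inj₁ (spread-⊊ m startU us us′ U-end U′-end≤m v∈U (λ { refl → v∉U′ (start∈points startU us′) })
            v∉U′ v∉turnsU (upper-kept v∈U))
  y-spread-⊊ _ v∉turnsL (inj₂ v∈L) with ⊆⊎counterexample U U′
  ... | inj₂ (q , q∈U , q∉U′) =
    inj₁ (spread-⊊ m startU us us′ U-end U′-end≤m q∈U (λ { refl → q∉U′ (start∈points startU us′) })
            q∉U′ (lost-upper∉turns v∈L q∈U q∉U′) rest-of-U)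
    where
    rest-of-U : ∀ {r} → r ∈ U → r ≢ q → r ∈ U′
    rest-of-U r∈U r≢q = upper-kept-off-diag r∈U
      λ eq → r≢q (points-diag-injective startU us r∈U q∈U (trans eq (sym (lost-upper-on-diag q∈U q∉U′))))
  ... | inj₁ U⊆U′ with same-end∧points-⊆⇒≡ startU us us′ U-end U⊆U′
  ...   | refl = inj₂ (refl , spread-⊊ m startL ls ls′ L-end L′-end≤m v∈L
                               (λ { refl → v∉L′ (start∈points startL ls′) }) v∉L′ v∉turnsL rest-of-L)
    where
    rest-of-L : ∀ {r} → r ∈ L → r ≢ v → r ∈ L′
    rest-of-L r∈L r≢v with rest⊆ (inj₂ r∈L) r≢v
    ... | inj₁ r∈U = ⊥-elim (F-disj _ r∈U r∈L)
    ... | inj₂ r∈L′ = r∈L′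

-- Facets

point≡start⊎≺start : ∀ p ds → q ∈ points p ds → q ≡ p ⊎ q ≺ p
point≡start⊎≺start {q} p ds q∈ with start≤ᴾpoint p ds q∈ | row p ≟ row q | col p ≟ col q
... | _ , _        | yes refl | yes refl = inj₁ refl
... | _ , col≤     | yes refl | no col≢  = inj₂ (inj₂ (refl , ≤∧≢⇒< col≤ col≢))
... | row≤ , _     | no row≢  | _        = inj₂ (inj₁ (≤∧≢⇒< row≤ row≢))

points-along-row : ∀ p ds {c} → row (endPt p ds) ≡ row p → col p ≤ c → c ≤ col (endPt p ds)
  → (row p , c) ∈ points p ds
points-along-row p ds {c} same-row lo hi
  with points-meet-diag p ds (+-monoʳ-≤ (row p) lo)
         (+-mono-≤ (≤-reflexive (sym same-row)) hi)
... | q , q∈ , diag-q = subst (_∈ points p ds) (row≡∧diag≡⇒≡ q-row diag-q) q∈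
  where
  q-row : row q ≡ row p
  q-row = ≤-antisym (subst (row q ≤_) same-row (proj₁ (point≤ᴾend p ds q∈))) (proj₁ (start≤ᴾpoint p ds q∈))

variable
  m n : ℕ
  v w : Var

lead-row≤m : ∀ F → IsFacet m n F → li F ≤ m
lead-row≤m F (_ , i≤m , _) = i≤m

lead-col≤n : ∀ F → IsFacet m n F → lj F ≤ n
lead-col≤n F (_ , _ , _ , j≤n , _) = j≤n

lead≢corner : ∀ F → IsFacet m n F → lead F ≢ (m , n)
lead≢corner F (_ , _ , _ , _ , lead≢ , _) = lead≢

x-end : ∀ F → IsFacet m n F → endPt (lead F) (xs F) ≡ (m , n)
x-end F (_ , _ , _ , _ , _ , end , _) = end

u-end : ∀ F → IsFacet m n F → endPt startU (us F) ≡ (li F , n)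
u-end F (_ , _ , _ , _ , _ , _ , end , _) = end

l-end : ∀ F → IsFacet m n F → endPt startL (ls F) ≡ (m , lj F)
l-end F (_ , _ , _ , _ , _ , _ , _ , end , _) = end

y-disjoint : ∀ F → IsFacet m n F → YDisjoint (us F) (ls F)
y-disjoint F (_ , _ , _ , _ , _ , _ , _ , _ , disj) = disj

u-end-row≤m : ∀ F → IsFacet m n F → row (endPt startU (us F)) ≤ m
u-end-row≤m F fF = subst (_≤ _) (sym (cong row (u-end F fF))) (lead-row≤m F fF)

l-end-row≡m : ∀ F → IsFacet m n F → row (endPt startL (ls F)) ≡ m
l-end-row≡m F fF = cong row (l-end F fF)

xAt yAt : Pt → Var
xAt q = x (row q) (col q)
yAt q = y (row q) (col q)

xAt-injective : xAt q ≡ xAt r → q ≡ r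
xAt-injective refl = refl

yAt-injective : yAt q ≡ yAt r → q ≡ r
yAt-injective refl = refl

_≟ⱽ_ : DecidableEquality Var
x a b ≟ⱽ x c d with (a , b) ≟ᴾ (c , d)
... | yes refl = yes refl
... | no ≢     = no (≢ ∘ xAt-injective)
x a b ≟ⱽ y c d = no λ ()
y a b ≟ⱽ x c d = no λ ()
y a b ≟ⱽ y c d with (a , b) ≟ᴾ (c , d)
... | yes refl = yes refl
... | no ≢     = no (≢ ∘ yAt-injective)

InF? : ∀ F v → Dec (InF F v)
InF? F (x a b) = (a , b) ∈? points (lead F) (xs F)
InF? F (y a b) = (a , b) ∈? points startU (us F) ⊎-dec (a , b) ∈? points startL (ls F)

ESTurn? : ∀ F v → Dec (ESTurn F v)
ESTurn? F (x a b) = any? ((a , b) ≟ᴾ_) (turns (lead F) (xs F))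
ESTurn? F (y a b) = any? ((a , b) ≟ᴾ_) (turns startU (us F)) ⊎-dec any? ((a , b) ≟ᴾ_) (turns startL (ls F))

record SingleDifference (F S : Facet) (v : Var) : Set where
  field
    removed : InF F v
    absent  : ¬ InF S v
    kept    : ∀ {w} → InF F w → w ≢ v → InF S w
open SingleDifference

singleDifference⇒⇔ : ∀ {F S} → SingleDifference F S v → ∀ w → (InF F w × ¬ InF S w) ⇔ (w ≡ v)
singleDifference⇒⇔ {v = v} {F} {S} diff w = mk⇔ to from
  where
  to : InF F w × ¬ InF S w → w ≡ v
  to (w∈F , w∉S) with w ≟ⱽ v
  ... | yes w≡v = w≡v
  ... | no  w≢v = ⊥-elim (w∉S (kept diff w∈F w≢v))
  from : w ≡ v → InF F w × ¬ InF S w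
  from refl = removed diff , absent diff

⇔⇒singleDifference : ∀ F S v → (∀ w → (InF F w × ¬ InF S w) ⇔ (w ≡ v)) → SingleDifference F S v
⇔⇒singleDifference F S v diff = record
  { removed = proj₁ (Equivalence.from (diff v) refl)
  ; absent  = proj₂ (Equivalence.from (diff v) refl)
  ; kept    = kept′
  }
  where
  kept′ : ∀ {w} → InF F w → w ≢ v → InF S w
  kept′ {w} w∈F w≢v with InF? S w
  ... | yes w∈S = w∈S
  ... | no  w∉S = ⊥-elim (w≢v (Equivalence.to (diff w) (w∈F , w∉S)))

CornerWitness : ℕ → ℕ → Facet → Var → Set
CornerWitness m n F v = Σ Facet λ S → IsFacet m n S × FLt m S F × SingleDifference F S v

non-turn-difference⇒< : ∀ {F S} → IsFacet m n F → IsFacet m n S → SingleDifference F S v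
  → v ≢ x (li F) (lj F) → ¬ ESTurn F v → FLt m F S
non-turn-difference⇒< {m} {n} {v} {F@(facet i j xs us ls)} {S@(facet i′ j′ xs′ us′ ls′)} fF fS diff v≢lead not-turn
  with point≡start⊎≺start (i′ , j′) xs′ (kept diff (start∈points (i , j) xs) (v≢lead ∘ sym))
... | inj₂ lead-F≺lead-S = inj₁ lead-F≺lead-S
... | inj₁ refl with v
...   | x a b = inj₂ (inj₁ (refl , spread-⊊ m (i , j) xs xs′ (trans (x-end F fF) (sym (x-end S fS)))
                           (≤-reflexive (cong row (x-end S fS))) (removed diff) (v≢lead ∘ cong xAt)
                           (absent diff) not-turn (λ q∈ q≢ → kept diff q∈ (q≢ ∘ xAt-injective))))
...   | y a b
  with same-end∧points-⊆⇒≡ (i , j) xs xs′ (trans (x-end F fF) (sym (x-end S fS))) (λ q∈ → kept diff q∈ λ ())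
...     | refl with YS.y-spread-⊊ (not-turn ∘ inj₁) (not-turn ∘ inj₂) (removed diff)
  where
  module YS = CompareYPaths m us ls us′ ls′ (trans (u-end F fF) (sym (u-end S fS)))
    (trans (l-end F fF) (sym (l-end S fS))) (u-end-row≤m S fS) (≤-reflexive (l-end-row≡m S fS))
    (y-disjoint F fF) (y-disjoint S fS) (λ q∈ q≢ → kept diff q∈ (q≢ ∘ yAt-injective))
    (absent diff ∘ inj₁) (absent diff ∘ inj₂)
...       | inj₁ U-spread⊊          = inj₂ (inj₂ (inj₁ (refl , refl , U-spread⊊)))
...       | inj₂ (refl , L-spread⊊) = inj₂ (inj₂ (inj₂ (refl , refl , refl , L-spread⊊)))

-- ES-turns are corners

isFacet-repath : ∀ F xs′ us′ ls′ → IsFacet m n F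
  → endPt (lead F) xs′ ≡ (m , n) → endPt startU us′ ≡ (li F , n) → endPt startL ls′ ≡ (m , lj F)
  → YDisjoint us′ ls′ → IsFacet m n (facet (li F) (lj F) xs′ us′ ls′)
isFacet-repath F xs′ us′ ls′ (1≤i , i≤m , 1≤j , j≤n , lead≢ , _) x-end′ u-end′ l-end′ disj′ =
  1≤i , i≤m , 1≤j , j≤n , lead≢ , x-end′ , u-end′ , l-end′ , disj′

x-turn-witness : ∀ F → IsFacet m n F → ∀ {a b} → (a , b) ∈ turns (lead F) (xs F) → CornerWitness m n F (x a b)
x-turn-witness {m} {n} F@(facet i j xs us ls) fF t with turns-split (i , j) xs t
... | ds₁ , ds₂ , refl , refl =
  F′ , fF′ , inj₂ (inj₁ (refl , spread-viaSE⊊viaES m (≤-reflexive (cong row (x-end F fF))))) , diff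
  where
  open Flip (i , j) ds₁ ds₂
  F′ : Facet
  F′ = facet i j viaSE us ls
  fF′ : IsFacet m n F′
  fF′ = isFacet-repath F viaSE us ls fF (trans endPt-viaSE (x-end F fF)) (u-end F fF) (l-end F fF) (y-disjoint F fF)
  diff : SingleDifference F F′ (xAt es-corner)
  diff = record { removed = es-corner∈viaES ; absent = es-corner∉viaSE ; kept = kept′ }
    where
    kept′ : ∀ {w} → InF F w → w ≢ xAt es-corner → InF F′ w
    kept′ {x c d} w∈ w≢ = viaES∖es-corner⊆viaSE w∈ (w≢ ∘ cong xAt)
    kept′ {y c d} w∈ w≢ = w∈

lower-turn-witness : ∀ F → IsFacet m n F → ∀ {a b} → (a , b) ∈ turns startL (ls F) → CornerWitness m n F (y a b)
lower-turn-witness {m} {n} F@(facet i j xs us ls) fF t with turns-split startL ls t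
... | ds₁ , ds₂ , refl , refl =
  F′ , fF′ , inj₂ (inj₂ (inj₂ (refl , refl , refl , spread-viaSE⊊viaES m (≤-reflexive (l-end-row≡m F fF))))) , diff
  where
  open Flip startL ds₁ ds₂
  F′ : Facet
  F′ = facet i j xs us viaSE
  disj′ : YDisjoint us viaSE
  disj′ q q∈U q∈L′ with q ≟ᴾ se-corner
  ... | yes refl = 1+n≰n (≤-trans (n≤1+n _)
                     (upper-row<lower-row us viaES (y-disjoint F fF) q∈U es-corner∈viaES (diag-move-D≡R base)))
  ... | no q≢se  = y-disjoint F fF q q∈U (viaSE∖se-corner⊆viaES q∈L′ q≢se)
  fF′ : IsFacet m n F′
  fF′ = isFacet-repath F xs us viaSE fF (x-end F fF) (u-end F fF) (trans endPt-viaSE (l-end F fF)) disj′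
  diff : SingleDifference F F′ (yAt es-corner)
  diff = record { removed = inj₂ es-corner∈viaES ; absent = absent′ ; kept = kept′ }
    where
    absent′ : ¬ InF F′ (yAt es-corner)
    absent′ (inj₁ c∈U) = y-disjoint F fF _ c∈U es-corner∈viaES
    absent′ (inj₂ c∈L′) = es-corner∉viaSE c∈L′
    kept′ : ∀ {w} → InF F w → w ≢ yAt es-corner → InF F′ w
    kept′ {x c d} w∈ w≢ = w∈
    kept′ {y c d} (inj₁ w∈U) w≢ = inj₁ w∈U
    kept′ {y c d} (inj₂ w∈L) w≢ = inj₂ (viaES∖es-corner⊆viaSE w∈L (w≢ ∘ cong yAt))

module _ (i j : ℕ) (xs : List Dir) (ds₁ ds₂ : List Dir) where
  open Flip startU ds₁ ds₂

  upper-flip-witness : ∀ ls → IsFacet m n (facet i j xs viaES ls) → se-corner ∉ points startL ls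
    → CornerWitness m n (facet i j xs viaES ls) (yAt es-corner)
  upper-flip-witness {m} {n} ls fF se∉L =
    F′ , fF′ , inj₂ (inj₂ (inj₁ (refl , refl , spread-viaSE⊊viaES m (u-end-row≤m F fF)))) , diff
    where
    F F′ : Facet
    F  = facet i j xs viaES ls
    F′ = facet i j xs viaSE ls
    disj′ : YDisjoint viaSE ls
    disj′ q q∈U′ q∈L with q ≟ᴾ se-corner
    ... | yes refl = se∉L q∈L
    ... | no q≢se  = y-disjoint F fF q (viaSE∖se-corner⊆viaES q∈U′ q≢se) q∈L
    fF′ : IsFacet m n F′
    fF′ = isFacet-repath F xs viaSE ls fF (x-end F fF) (trans endPt-viaSE (u-end F fF)) (l-end F fF) disj′
    diff : SingleDifference F F′ (yAt es-corner)
    diff = record { removed = inj₁ es-corner∈viaES ; absent = absent′ ; kept = kept′ }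
      where
      absent′ : ¬ InF F′ (yAt es-corner)
      absent′ (inj₁ c∈U′) = es-corner∉viaSE c∈U′
      absent′ (inj₂ c∈L)  = y-disjoint F fF _ es-corner∈viaES c∈L
      kept′ : ∀ {w} → InF F w → w ≢ yAt es-corner → InF F′ w
      kept′ {x c d} w∈ w≢ = w∈
      kept′ {y c d} (inj₁ w∈U) w≢ = inj₁ (viaES∖es-corner⊆viaSE w∈U (w≢ ∘ cong yAt))
      kept′ {y c d} (inj₂ w∈L) w≢ = inj₂ w∈L

  lower-through-se-corner : ∀ ls → IsFacet m n (facet i j xs viaES ls) → se-corner ∈ points startL ls
    → es-corner ≢ (1 , 2) → ¬ (es-corner ≡ (m ∸ 1 , j + 1) × i ≡ m × j < n)
    → ∃₂ λ ls₁ ls₂ → ls ≡ ls₁ ++ R ∷ D ∷ ls₂ × move R (endPt startL ls₁) ≡ se-corner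
  lower-through-se-corner {m} {n} ls (_ , i≤m , _ , _ , _ , _ , U-end , L-end , disj) se∈L not-12 not-exc
    with points-pred startL ls se∈L (λ se≡start → not-12 (cong (move R) (move-injective D se≡start)))
  ... | D , f , f∈L , se≡ = ⊥-elim (disj f (subst (_∈ points startU viaES) (move-injective D se≡) base∈viaES) f∈L)
  ... | R , f , f∈L , se≡ with points-succ startL ls se∈L se≢end
    where
    se≢end : se-corner ≢ endPt startL ls
    se≢end se≡end = not-exc (es-corner≡ , i≡m , j<n)
      where
      se≡mj : se-corner ≡ (m , j)
      se≡mj = trans se≡end L-end
      below-es≤end : move D es-corner ≤ᴾ (i , n)
      below-es≤end = subst (_ ≤ᴾ_) U-end (point≤ᴾend startU viaES below-es-corner∈viaES)
      es-corner≡ : es-corner ≡ (m ∸ 1 , j + 1)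
      es-corner≡ = cong₂ _,_ (cong (_∸ 1) (,-injectiveˡ se≡mj)) (trans (cong suc (,-injectiveʳ se≡mj)) (+-comm 1 j))
      i≡m : i ≡ m
      i≡m = ≤-antisym i≤m (subst (_≤ i) (,-injectiveˡ se≡mj) (proj₁ below-es≤end))
      j<n : j < n
      j<n = subst (λ c → suc c ≤ n) (,-injectiveʳ se≡mj) (proj₂ below-es≤end)
  ...   | R , h = ⊥-elim (disj _ below-es-corner∈viaES h)
  ...   | D , h with two-step-split {d = R} {e = D} startL ls f∈L (subst (_∈ points startL ls) se≡ se∈L)
                                                             (subst (λ z → move D z ∈ points startL ls) se≡ h)
  ...     | ls₁ , ls₂ , refl , refl = ls₁ , ls₂ , refl , sym se≡

  -- When the south-east corner of the flipped upper path lies on the lower path, the lower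
  -- path is flipped there as well, moving it out of the way.
  upper-double-flip-witness : ∀ ls₁ ls₂ → let module FL = Flip startL ls₁ ls₂ in
    IsFacet m n (facet i j xs viaES FL.viaES) → FL.es-corner ≡ se-corner
    → CornerWitness m n (facet i j xs viaES FL.viaES) (yAt es-corner)
  upper-double-flip-witness {m} {n} ls₁ ls₂ fF esL≡se =
    F′ , fF′ , inj₂ (inj₂ (inj₁ (refl , refl , spread-viaSE⊊viaES m (u-end-row≤m F fF)))) , diff
    where
    module FL = Flip startL ls₁ ls₂
    F F′ : Facet
    F  = facet i j xs viaES FL.viaES
    F′ = facet i j xs viaSE FL.viaSE
    rows : row FL.base ≡ suc (row base)
    rows = cong row esL≡se
    seL∉U : FL.se-corner ∉ points startU viaES
    seL∉U seL∈U = 1+n≰n (≤-trans (≤-reflexive (cong col esL≡se))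
      (points-row<⇒col≤ startU viaES base∈viaES seL∈U (≤-trans (n≤1+n _) (s≤s (≤-reflexive (sym rows))))))
    disj′ : YDisjoint viaSE FL.viaSE
    disj′ q q∈U′ q∈L′ with q ≟ᴾ se-corner
    ... | yes refl = FL.es-corner∉viaSE (subst (_∈ points startL FL.viaSE) (sym esL≡se) q∈L′)
    ... | no q≢se with q ≟ᴾ FL.se-corner
    ...   | yes refl = seL∉U (viaSE∖se-corner⊆viaES q∈U′ q≢se)
    ...   | no q≢seL = y-disjoint F fF q (viaSE∖se-corner⊆viaES q∈U′ q≢se) (FL.viaSE∖se-corner⊆viaES q∈L′ q≢seL)
    fF′ : IsFacet m n F′
    fF′ = isFacet-repath F xs viaSE FL.viaSE fF (x-end F fF) (trans endPt-viaSE (u-end F fF))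
            (trans FL.endPt-viaSE (l-end F fF)) disj′
    diff : SingleDifference F F′ (yAt es-corner)
    diff = record { removed = inj₁ es-corner∈viaES ; absent = absent′ ; kept = kept′ }
      where
      absent′ : ¬ InF F′ (yAt es-corner)
      absent′ (inj₁ c∈U′) = es-corner∉viaSE c∈U′
      absent′ (inj₂ c∈L′) with es-corner ≟ᴾ FL.se-corner
      ... | yes c≡seL = <⇒≢ (m<n⇒m<1+n (n<1+n _)) (trans (cong row c≡seL) (cong suc rows))
      ... | no c≢seL  = y-disjoint F fF _ es-corner∈viaES (FL.viaSE∖se-corner⊆viaES c∈L′ c≢seL)
      kept′ : ∀ {w} → InF F w → w ≢ yAt es-corner → InF F′ w
      kept′ {x c d} w∈ w≢ = w∈
      kept′ {y c d} (inj₁ w∈U) w≢ = inj₁ (viaES∖es-corner⊆viaSE w∈U (w≢ ∘ cong yAt))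
      kept′ {y c d} (inj₂ w∈L) w≢ with (c , d) ≟ᴾ FL.es-corner
      ... | yes refl     = inj₁ (subst (_∈ points startU viaSE) (sym esL≡se) se-corner∈viaSE)
      ... | no w≢esL     = inj₂ (FL.viaES∖es-corner⊆viaSE w∈L w≢esL)

upper-turn-witness : ∀ F → IsFacet m n F → ∀ {a b} → (a , b) ∈ turns startU (us F) → (a , b) ≢ (1 , 2)
  → ¬ ((a , b) ≡ (m ∸ 1 , lj F + 1) × li F ≡ m × lj F < n) → CornerWitness m n F (y a b)
upper-turn-witness F@(facet i j xs us ls) fF t not-12 not-exc with turns-split startU us t
... | ds₁ , ds₂ , refl , refl with Flip.se-corner startU ds₁ ds₂ ∈? points startL ls
...   | no se∉L = upper-flip-witness i j xs ds₁ ds₂ ls fF se∉L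
...   | yes se∈L with lower-through-se-corner i j xs ds₁ ds₂ ls fF se∈L not-12 not-exc
...     | ls₁ , ls₂ , refl , esL≡se = upper-double-flip-witness i j xs ds₁ ds₂ ls₁ ls₂ fF esL≡se

-- The lead is a corner

lead-step-isFacet : ∀ {i j} d xs us ls → 1 ≤ i → 1 ≤ j → endPt (i , j) (d ∷ xs) ≡ (m , n)
  → move d (i , j) ≢ (m , n)
  → endPt startU us ≡ (row (move d (i , j)) , n) → endPt startL ls ≡ (m , col (move d (i , j)))
  → YDisjoint us ls
  → IsFacet m n (facet (row (move d (i , j))) (col (move d (i , j))) xs us ls)
lead-step-isFacet {i = i} {j} d xs us ls 1≤i 1≤j x-end′ lead≢ u-end′ l-end′ disj =
  ≤-trans 1≤i (proj₁ (≤ᴾ-move d (i , j))) , proj₁ new-lead≤end ,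
  ≤-trans 1≤j (proj₂ (≤ᴾ-move d (i , j))) , proj₂ new-lead≤end ,
  lead≢ , x-end′ , u-end′ , l-end′ , disj
  where
  new-lead≤end : move d (i , j) ≤ᴾ (_ , _)
  new-lead≤end = subst (move d (i , j) ≤ᴾ_) x-end′ (start≤ᴾpoint (move d (i , j)) xs (end∈points _ xs))

lead-step-difference : ∀ {i j} d xs us ls us′ ls′
  → (∀ {q} → q ∈ points startU us ⊎ q ∈ points startL ls → q ∈ points startU us′ ⊎ q ∈ points startL ls′)
  → SingleDifference (facet i j (d ∷ xs) us ls)
                     (facet (row (move d (i , j))) (col (move d (i , j))) xs us′ ls′) (x i j)
lead-step-difference {i = i} {j} d xs us ls us′ ls′ y⊆ = record
  { removed = here refl
  ; absent  = λ lead∈ → move≰ᴾ d (i , j) (start≤ᴾpoint (move d (i , j)) xs lead∈)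
  ; kept    = kept′
  }
  where
  kept′ : ∀ {w} → InF (facet i j (d ∷ xs) us ls) w → w ≢ x i j
        → InF (facet (row (move d (i , j))) (col (move d (i , j))) xs us′ ls′) w
  kept′ {x c e} (here refl) w≢ = ⊥-elim (w≢ refl)
  kept′ {x c e} (there w∈) w≢ = w∈
  kept′ {y c e} w∈ w≢ = y⊆ w∈

lead-right-witness : ∀ i j xs us ls → IsFacet m n (facet i j (R ∷ xs) us ls) → (i , j) ≢ (m , n ∸ 1)
  → (m , suc j) ∉ points startU us → CornerWitness m n (facet i j (R ∷ xs) us ls) (x i j)
lead-right-witness {m} {n} i j xs us ls fF@(1≤i , _ , 1≤j , _) lead≢ c∉U =
  facet i (suc j) xs us (ls ∷ʳ R) , fF′ , inj₁ (inj₂ (refl , ≤-refl)) ,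
  lead-step-difference R xs us ls us (ls ∷ʳ R) y⊆
  where
  F : Facet
  F = facet i j (R ∷ xs) us ls
  disj′ : YDisjoint us (ls ∷ʳ R)
  disj′ q q∈U q∈L′ with points-∷ʳ⁻ startL ls R q∈L′
  ... | inj₁ q∈L = y-disjoint F fF q q∈U q∈L
  ... | inj₂ refl = c∉U (subst (λ z → move R z ∈ points startU us) (l-end F fF) q∈U)
  fF′ : IsFacet m n (facet i (suc j) xs us (ls ∷ʳ R))
  fF′ = lead-step-isFacet R xs us (ls ∷ʳ R) 1≤i 1≤j (x-end F fF)
          (λ eq → lead≢ (cong₂ _,_ (,-injectiveˡ eq) (cong (_∸ 1) (,-injectiveʳ eq))))
          (u-end F fF) (trans (endPt-∷ʳ startL ls R) (cong (move R) (l-end F fF))) disj′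
  y⊆ : ∀ {q} → q ∈ points startU us ⊎ q ∈ points startL ls → q ∈ points startU us ⊎ q ∈ points startL (ls ∷ʳ R)
  y⊆ (inj₁ q∈U) = inj₁ q∈U
  y⊆ (inj₂ q∈L) = inj₂ (points-++ˡ startL ls (R ∷ []) q∈L)

lead-down-witness : ∀ i j xs us ls → IsFacet m n (facet i j (D ∷ xs) us ls)
  → (suc i , n) ∉ points startL ls → CornerWitness m n (facet i j (D ∷ xs) us ls) (x i j)
lead-down-witness {m} {n} i j xs us ls fF@(1≤i , _ , 1≤j , _) c∉L =
  facet (suc i) j xs (us ∷ʳ D) ls , fF′ , inj₁ (inj₁ ≤-refl) ,
  lead-step-difference D xs us ls (us ∷ʳ D) ls y⊆
  where
  F : Facet
  F = facet i j (D ∷ xs) us ls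
  disj′ : YDisjoint (us ∷ʳ D) ls
  disj′ q q∈U′ q∈L with points-∷ʳ⁻ startU us D q∈U′
  ... | inj₁ q∈U = y-disjoint F fF q q∈U q∈L
  ... | inj₂ refl = c∉L (subst (λ z → move D z ∈ points startL ls) (u-end F fF) q∈L)
  fF′ : IsFacet m n (facet (suc i) j xs (us ∷ʳ D) ls)
  fF′ = lead-step-isFacet D xs (us ∷ʳ D) ls 1≤i 1≤j (x-end F fF)
          (λ eq → c∉L (subst (_∈ points startL ls) (trans (l-end F fF) (cong₂ _,_ (sym (,-injectiveˡ eq)) (,-injectiveʳ eq)))
                                (end∈points startL ls)))
          (trans (endPt-∷ʳ startU us D) (cong (move D) (u-end F fF))) (l-end F fF) disj′
  y⊆ : ∀ {q} → q ∈ points startU us ⊎ q ∈ points startL ls → q ∈ points startU (us ∷ʳ D) ⊎ q ∈ points startL ls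
  y⊆ (inj₁ q∈U) = inj₁ (points-++ˡ startU us (D ∷ []) q∈U)
  y⊆ (inj₂ q∈L) = inj₂ q∈L

upper-split-below-lead : 1 < m → ∀ i j xs us ls → IsFacet m n (facet i j (R ∷ xs) us ls) → (i , j) ≢ (m , n ∸ 1)
  → (m , suc j) ∈ points startU us
  → ∃₂ λ us₁ us₂ → us ≡ us₁ ++ D ∷ R ∷ us₂ × move D (endPt startU us₁) ≡ (m , suc j)
upper-split-below-lead {m} {n} 1<m i j xs us ls (_ , i≤m , _ , _ , _ , _ , U-end , L-end , disj) lead≢ c∈U
  with points-pred startU us c∈U (λ c≡start → <⇒≢ 1<m (sym (,-injectiveˡ c≡start)))
... | R , w , w∈U , c≡ =
  ⊥-elim (disj w w∈U (subst (_∈ points startL ls) (trans L-end (move-injective R c≡)) (end∈points startL ls)))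
... | D , w , w∈U , c≡ with points-succ startU us c∈U c≢end
  where
  c≢end : (m , suc j) ≢ endPt startU us
  c≢end c≡end = lead≢ (cong₂ _,_ (sym (,-injectiveˡ c≡U-end)) (cong (_∸ 1) (,-injectiveʳ c≡U-end)))
    where
    c≡U-end : (m , suc j) ≡ (i , n)
    c≡U-end = trans c≡end U-end
...   | D , h = ⊥-elim (1+n≰n (≤-trans (proj₁ (point≤ᴾend startU us h)) (subst (_≤ m) (sym (cong row U-end)) i≤m)))
...   | R , h with two-step-split {d = D} {e = R} startU us w∈U (subst (_∈ points startU us) c≡ c∈U)
                                                   (subst (λ z → move R z ∈ points startU us) c≡ h)
...     | us₁ , us₂ , refl , refl = us₁ , us₂ , refl , sym c≡

lower-split-right-of-lead : 1 < n → ∀ i j xs us ls → IsFacet m n (facet i j (D ∷ xs) us ls) → suc i ≢ m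
  → (suc i , n) ∈ points startL ls
  → ∃₂ λ ls₁ ls₂ → ls ≡ ls₁ ++ R ∷ D ∷ ls₂ × move R (endPt startL ls₁) ≡ (suc i , n)
lower-split-right-of-lead {n} {m} 1<n i j xs us ls (_ , _ , _ , j≤n , _ , _ , U-end , L-end , disj) 1+i≢m c∈L
  with points-pred startL ls c∈L (λ c≡start → <⇒≢ 1<n (sym (,-injectiveʳ c≡start)))
... | D , w , w∈L , c≡ =
  ⊥-elim (disj w (subst (_∈ points startU us) (trans U-end (move-injective D c≡)) (end∈points startU us)) w∈L)
... | R , w , w∈L , c≡ with points-succ startL ls c∈L (λ c≡end → 1+i≢m (,-injectiveˡ (trans c≡end L-end)))
...   | R , h = ⊥-elim (1+n≰n (≤-trans (proj₂ (point≤ᴾend startL ls h)) (subst (_≤ n) (sym (cong col L-end)) j≤n)))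
...   | D , h with two-step-split {d = R} {e = D} startL ls w∈L (subst (_∈ points startL ls) c≡ c∈L)
                                                   (subst (λ z → move D z ∈ points startL ls) c≡ h)
...     | ls₁ , ls₂ , refl , refl = ls₁ , ls₂ , refl , sym c≡

module _ (i j : ℕ) (xs us₁ us₂ ls : List Dir) where
  open Flip startU us₁ us₂

  lead-right-flip-witness : IsFacet m n (facet i j (R ∷ xs) viaSE ls) → (i , j) ≢ (m , n ∸ 1)
    → se-corner ≡ (m , suc j) → CornerWitness m n (facet i j (R ∷ xs) viaSE ls) (x i j)
  lead-right-flip-witness {m} {n} fF@(1≤i , _ , 1≤j , _) lead≢ se≡ =
    facet i (suc j) xs viaES (ls ∷ʳ R) , fF′ , inj₁ (inj₂ (refl , ≤-refl)) ,
    lead-step-difference R xs viaSE ls viaES (ls ∷ʳ R) y⊆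
    where
    F : Facet
    F = facet i j (R ∷ xs) viaSE ls
    new-end≡se : move R (endPt startL ls) ≡ se-corner
    new-end≡se = trans (cong (move R) (l-end F fF)) (sym se≡)
    disj′ : YDisjoint viaES (ls ∷ʳ R)
    disj′ q q∈U′ q∈L′ with points-∷ʳ⁻ startL ls R q∈L′
    ... | inj₂ refl = se-corner∉viaES (subst (_∈ points startU viaES) new-end≡se q∈U′)
    ... | inj₁ q∈L with q ≟ᴾ es-corner
    ...   | yes refl = 1+n≰n (≤-trans (n≤1+n _) (subst₂ (λ a b → suc a ≤ b) (cong col se≡) (cong col (l-end F fF))
                         (proj₂ (point≤ᴾend startL ls q∈L))))
    ...   | no q≢es  = y-disjoint F fF q (viaES∖es-corner⊆viaSE q∈U′ q≢es) q∈L
    fF′ : IsFacet m n (facet i (suc j) xs viaES (ls ∷ʳ R))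
    fF′ = lead-step-isFacet R xs viaES (ls ∷ʳ R) 1≤i 1≤j (x-end F fF)
            (λ eq → lead≢ (cong₂ _,_ (,-injectiveˡ eq) (cong (_∸ 1) (,-injectiveʳ eq))))
            (trans (sym endPt-viaSE) (u-end F fF)) (trans (endPt-∷ʳ startL ls R) (cong (move R) (l-end F fF))) disj′
    y⊆ : ∀ {q} → q ∈ points startU viaSE ⊎ q ∈ points startL ls → q ∈ points startU viaES ⊎ q ∈ points startL (ls ∷ʳ R)
    y⊆ {q} (inj₁ q∈U) with q ≟ᴾ se-corner
    ... | yes refl = inj₂ (subst (_∈ points startL (ls ∷ʳ R)) new-end≡se (new-end∈points-∷ʳ startL ls R))
    ... | no q≢se  = inj₁ (viaSE∖se-corner⊆viaES q∈U q≢se)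
    y⊆ (inj₂ q∈L) = inj₂ (points-++ˡ startL ls (R ∷ []) q∈L)

module _ (i j : ℕ) (xs us ls₁ ls₂ : List Dir) where
  open Flip startL ls₁ ls₂

  lead-down-flip-witness : IsFacet m n (facet i j (D ∷ xs) us viaES) → suc i ≢ m
    → es-corner ≡ (suc i , n) → CornerWitness m n (facet i j (D ∷ xs) us viaES) (x i j)
  lead-down-flip-witness {m} {n} fF@(1≤i , _ , 1≤j , _) 1+i≢m es≡ =
    facet (suc i) j xs (us ∷ʳ D) viaSE , fF′ , inj₁ (inj₁ ≤-refl) ,
    lead-step-difference D xs us viaES (us ∷ʳ D) viaSE y⊆
    where
    F : Facet
    F = facet i j (D ∷ xs) us viaES
    new-end≡es : move D (endPt startU us) ≡ es-corner
    new-end≡es = trans (cong (move D) (u-end F fF)) (sym es≡)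
    disj′ : YDisjoint (us ∷ʳ D) viaSE
    disj′ q q∈U′ q∈L′ with points-∷ʳ⁻ startU us D q∈U′
    ... | inj₂ refl = es-corner∉viaSE (subst (_∈ points startL viaSE) new-end≡es q∈L′)
    ... | inj₁ q∈U with q ≟ᴾ se-corner
    ...   | yes refl = 1+n≰n (≤-trans (n≤1+n _) (subst₂ (λ a b → suc a ≤ b) (cong row es≡) (cong row (u-end F fF))
                         (proj₁ (point≤ᴾend startU us q∈U))))
    ...   | no q≢se  = y-disjoint F fF q q∈U (viaSE∖se-corner⊆viaES q∈L′ q≢se)
    fF′ : IsFacet m n (facet (suc i) j xs (us ∷ʳ D) viaSE)
    fF′ = lead-step-isFacet D xs (us ∷ʳ D) viaSE 1≤i 1≤j (x-end F fF) (1+i≢m ∘ ,-injectiveˡ)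
            (trans (endPt-∷ʳ startU us D) (cong (move D) (u-end F fF))) (trans endPt-viaSE (l-end F fF)) disj′
    y⊆ : ∀ {q} → q ∈ points startU us ⊎ q ∈ points startL viaES → q ∈ points startU (us ∷ʳ D) ⊎ q ∈ points startL viaSE
    y⊆ (inj₁ q∈U) = inj₁ (points-++ˡ startU us (D ∷ []) q∈U)
    y⊆ {q} (inj₂ q∈L) with q ≟ᴾ es-corner
    ... | yes refl = inj₁ (subst (_∈ points startU (us ∷ʳ D)) new-end≡es (new-end∈points-∷ʳ startU us D))
    ... | no q≢es  = inj₂ (viaES∖es-corner⊆viaSE q∈L q≢es)

-- Here F_x = x_{m-1,n} x_{m,n}; the earlier facet has F_x = x_{m,n-1} x_{m,n} and hands
-- y_{m,n} from the lower to the upper path.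
last-column-lead-witness : 1 < n → ∀ i us ls₁ → endPt startU us ≡ (i , n) → YDisjoint us (ls₁ ∷ʳ R)
  → suc i ≡ m → endPt startL ls₁ ≡ (m , n ∸ 1)
  → CornerWitness m n (facet i n (D ∷ []) us (ls₁ ∷ʳ R)) (x i n)
last-column-lead-witness {n} {m} 1<n i us ls₁ U-end disj 1+i≡m L₁-end =
  F′ , fF′ , inj₁ (inj₁ (≤-reflexive 1+i≡m)) , diff
  where
  F F′ : Facet
  F  = facet i n (D ∷ []) us (ls₁ ∷ʳ R)
  F′ = facet m (n ∸ 1) (R ∷ []) (us ∷ʳ D) ls₁
  n′≡n : suc (n ∸ 1) ≡ n
  n′≡n = suc[k∸1]≡k 1<n
  below-U-end≡ : move D (endPt startU us) ≡ (m , n)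
  below-U-end≡ = trans (cong (move D) U-end) (cong (_, n) 1+i≡m)
  disj′ : YDisjoint (us ∷ʳ D) ls₁
  disj′ q q∈U′ q∈L₁ with points-∷ʳ⁻ startU us D q∈U′
  ... | inj₁ q∈U = disj q q∈U (points-++ˡ startL ls₁ (R ∷ []) q∈L₁)
  ... | inj₂ refl = 1+n≰n (subst₂ _≤_ (sym n′≡n) (cong col L₁-end)
                      (subst (λ z → col z ≤ _) below-U-end≡ (proj₂ (point≤ᴾend startL ls₁ q∈L₁))))
  fF′ : IsFacet m n F′
  fF′ = subst (1 ≤_) 1+i≡m (s≤s z≤n) , ≤-refl , ∸-monoˡ-≤ 1 1<n , m∸n≤m n 1
      , (λ eq → 1+n≢n (trans (sym (cong suc (,-injectiveʳ eq))) n′≡n)) , cong (m ,_) n′≡n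
      , trans (endPt-∷ʳ startU us D) below-U-end≡ , L₁-end , disj′
  diff : SingleDifference F F′ (x i n)
  diff = record
    { removed = here refl
    ; absent  = λ lead∈ → 1+n≰n (subst (_≤ i) (sym 1+i≡m) (proj₁ (start≤ᴾpoint (m , n ∸ 1) (R ∷ []) lead∈)))
    ; kept    = kept′
    }
    where
    kept′ : ∀ {w} → InF F w → w ≢ x i n → InF F′ w
    kept′ {x c e} (here refl) w≢ = ⊥-elim (w≢ refl)
    kept′ {x c e} (there (here refl)) w≢ = there (here (cong₂ _,_ 1+i≡m (sym n′≡n)))
    kept′ {y c e} (inj₁ q∈U) w≢ = inj₁ (points-++ˡ startU us (D ∷ []) q∈U)
    kept′ {y c e} (inj₂ q∈L) w≢ with points-∷ʳ⁻ startL ls₁ R q∈L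
    ... | inj₁ q∈L₁ = inj₂ q∈L₁
    ... | inj₂ q≡   = inj₁ (subst (_∈ points startU (us ∷ʳ D))
                              (sym (trans q≡ (trans (cong (move R) L₁-end) (trans (cong (m ,_) n′≡n) (sym below-U-end≡)))))
                              (new-end∈points-∷ʳ startU us D))

lead-down-last-row-witness : 1 < n → ∀ i j xs us ls → IsFacet m n (facet i j (D ∷ xs) us ls) → suc i ≡ m
  → (suc i , n) ∈ points startL ls → CornerWitness m n (facet i j (D ∷ xs) us ls) (x i j)
lead-down-last-row-witness {n} {m} 1<n i j xs us ls (_ , _ , _ , j≤n , _ , x-end′ , U-end , L-end , disj) 1+i≡m c∈L
  with ≤-antisym j≤n (subst (n ≤_) (cong col L-end) (proj₂ (point≤ᴾend startL ls c∈L)))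
... | refl with xs
...   | e ∷ es = ⊥-elim (endPt-∷≢start (suc i , j) e es (trans x-end′ (cong (_, j) (sym 1+i≡m))))
...   | [] with points-pred startL ls (end∈points startL ls)
                  (λ end≡start → <⇒≢ 1<n (sym (trans (sym (cong col L-end)) (cong col end≡start))))
...     | D , w , w∈L , end≡ = ⊥-elim (disj w (subst (_∈ points startU us) w≡U-end (end∈points startU us)) w∈L)
  where
  w≡U-end : endPt startU us ≡ w
  w≡U-end = trans U-end (move-injective D (trans (cong (_, j) 1+i≡m) (trans (sym L-end) end≡)))
...     | R , w , w∈L , end≡ with step-split {d = R} startL ls w∈L (subst (_∈ points startL ls) end≡ (end∈points startL ls))
...       | ls₁ , e ∷ es , refl , refl =
  ⊥-elim (endPt-∷≢start (move R (endPt startL ls₁)) e es (trans (sym (endPt-++ startL ls₁ (R ∷ e ∷ es))) end≡))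
...       | ls₁ , [] , refl , refl =
  last-column-lead-witness 1<n i us ls₁ U-end disj 1+i≡m (cong₂ _,_ (,-injectiveˡ L₁-end′) (cong (_∸ 1) (,-injectiveʳ L₁-end′)))
  where
  L₁-end′ : move R (endPt startL ls₁) ≡ (m , j)
  L₁-end′ = trans (sym end≡) L-end

lead-witness : 1 < m → 1 < n → ∀ F → IsFacet m n F → lead F ≢ (m , n ∸ 1)
  → CornerWitness m n F (x (li F) (lj F))
lead-witness _ _ F@(facet i j [] us ls) fF _ = ⊥-elim (lead≢corner F fF (x-end F fF))
lead-witness {m} 1<m _ (facet i j (R ∷ xs) us ls) fF lead≢ with (m , suc j) ∈? points startU us
... | no c∉U = lead-right-witness i j xs us ls fF lead≢ c∉U
... | yes c∈U with upper-split-below-lead 1<m i j xs us ls fF lead≢ c∈U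
...   | us₁ , us₂ , refl , se≡ = lead-right-flip-witness i j xs us₁ us₂ ls fF lead≢ se≡
lead-witness {m} {n} _ 1<n (facet i j (D ∷ xs) us ls) fF _ with (suc i , n) ∈? points startL ls
... | no c∉L = lead-down-witness i j xs us ls fF c∉L
... | yes c∈L with suc i ≟ m
...   | yes 1+i≡m = lead-down-last-row-witness 1<n i j xs us ls fF 1+i≡m c∈L
...   | no 1+i≢m with lower-split-right-of-lead 1<n i j xs us ls fF 1+i≢m c∈L
...     | ls₁ , ls₂ , refl , es≡ = lead-down-flip-witness i j xs us ls₁ ls₂ fF 1+i≢m es≡

-- Corners

module _ {m n : ℕ} {rank : Facet → ℕ} (lin : IsLinearExtension m n rank) where

  witness⇒corner : ∀ F → IsFacet m n F → CornerWitness m n F v → Corner m n rank F v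
  witness⇒corner F fF (S , fS , S<F , diff) = S , fS , proj₂ lin S F fS fF S<F , singleDifference⇒⇔ diff

  corner⇒lead⊎turn : ∀ F → IsFacet m n F → Corner m n rank F v → v ≡ x (li F) (lj F) ⊎ ESTurn F v
  corner⇒lead⊎turn {v} F fF (S , fS , S-earlier , diff) with v ≟ⱽ x (li F) (lj F) | ESTurn? F v
  ... | yes v≡lead | _        = inj₁ v≡lead
  ... | no _       | yes turn = inj₂ turn
  ... | no v≢lead  | no ¬turn = ⊥-elim (<-asym S-earlier (proj₂ lin F S fF fS
          (non-turn-difference⇒< fF fS (⇔⇒singleDifference F S v diff) v≢lead ¬turn)))

  xₘₙ∉corners : ∀ F → IsFacet m n F → ¬ Corner m n rank F (x m n)
  xₘₙ∉corners F fF c with corner⇒lead⊎turn F fF c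
  ... | inj₁ eq   = lead≢corner F fF (sym (xAt-injective eq))
  ... | inj₂ turn = <⇒≱ (turn-row<end (lead F) (xs F) turn) (≤-reflexive (cong row (x-end F fF)))

  yₘₙ∉corners : ∀ F → IsFacet m n F → ¬ Corner m n rank F (y m n)
  yₘₙ∉corners F fF c with corner⇒lead⊎turn F fF c
  ... | inj₂ (inj₁ turn) = <⇒≱ (turn-row<end startU (us F) turn) (u-end-row≤m F fF)
  ... | inj₂ (inj₂ turn) = <⇒≱ (turn-row<end startL (ls F) turn) (≤-reflexive (l-end-row≡m F fF))

  -- x_{m,n-1} could only be a corner as the lead; but a facet S missing x_{m,n-1} cannot
  -- start in row m (its x-path would run through x_{m,n-1}), so lead F ≺ lead S.
  xₘₙ₋₁∉corners : ∀ F → IsFacet m n F → ¬ Corner m n rank F (x m (n ∸ 1))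
  xₘₙ₋₁∉corners F fF c with corner⇒lead⊎turn F fF c
  ... | inj₂ turn = <⇒≱ (turn-row<end (lead F) (xs F) turn) (≤-reflexive (cong row (x-end F fF)))
  ... | inj₁ eq with c
  ...   | S , fS , S-earlier , diff = <-asym S-earlier (proj₂ lin F S fF fS (inj₁ lead-F≺lead-S))
    where
    lead-F≡ : lead F ≡ (m , n ∸ 1)
    lead-F≡ = sym (xAt-injective eq)
    lead-F≺lead-S : lead F ≺ lead S
    lead-F≺lead-S with li S ≟ m
    ... | no  row≢ = inj₁ (subst (li S <_) (sym (,-injectiveˡ lead-F≡)) (≤∧≢⇒< (lead-row≤m S fS) row≢))
    ... | yes row≡ = ⊥-elim (proj₂ (Equivalence.from (diff _) refl)
          (subst (λ r → (r , n ∸ 1) ∈ points (lead S) (xs S)) row≡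
            (points-along-row (lead S) (xs S) (trans (cong row (x-end S fS)) (sym row≡))
               (<⇒≤∸1 (≤∧≢⇒< (lead-col≤n S fS) λ col≡ → lead≢corner S fS (cong₂ _,_ row≡ col≡)))
               (subst (n ∸ 1 ≤_) (sym (cong col (x-end S fS))) (m∸n≤m n 1)))))

lemma4p4 : (m n : ℕ) → 2 < m → m ≤ n
  → (rank : Facet → ℕ) → IsLinearExtension m n rank
  → (F : Facet) → IsFacet m n F
  → ((∀ v → Corner m n rank F v → (v ≡ x (li F) (lj F)) ⊎ ESTurn F v)
     × ¬ Corner m n rank F (x m n)
     × ¬ Corner m n rank F (y m n))
  × ((¬ (lead F ≡ (m , n ∸ 1)) → Corner m n rank F (x (li F) (lj F)))
     × ¬ Corner m n rank F (x m (n ∸ 1)))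
  × (∀ a b → (a , b) ∈ turns (lead F) (xs F) → Corner m n rank F (x a b))
  × (∀ a b → (a , b) ∈ turns startL (ls F) → Corner m n rank F (y a b))
  × (∀ a b → (a , b) ∈ turns startU (us F)
       → ¬ ((a , b) ≡ (1 , 2))
       → ¬ (((a , b) ≡ (m ∸ 1 , lj F + 1)) × (li F ≡ m) × (lj F < n))
       → Corner m n rank F (y a b))
lemma4p4 m n 2<m m≤n rank lin F fF =
  ( (λ _ → corner⇒lead⊎turn lin F fF) , xₘₙ∉corners lin F fF , yₘₙ∉corners lin F fF )
  , ( (λ lead≢ → corner (lead-witness 1<m 1<n F fF lead≢)) , xₘₙ₋₁∉corners lin F fF )
  , (λ _ _ turn → corner (x-turn-witness F fF turn))
  , (λ _ _ turn → corner (lower-turn-witness F fF turn))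
  , (λ _ _ turn not-y₁₂ not-exception → corner (upper-turn-witness F fF turn not-y₁₂ not-exception))
  where
  1<m : 1 < m
  1<m = ≤-trans (n≤1+n 2) 2<m
  1<n : 1 < n
  1<n = ≤-trans 1<m m≤n
  corner : ∀ {v} → CornerWitness m n F v → Corner m n rank F v
  corner = witness⇒corner lin F fF
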